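{- Let $n\ge 1$ be an integer and let $a=(a_1,\dots,a_n)$ be a good sequence of $[n]$. Then: (1) the sequence $b=(b_1,\dots,b_n)$ with $b_i=n+1-a_i$ is a good sequence; (2) if $a_{2l+1}\ge \lceil \frac{n+1}{2}\rceil$ for all $l$ with $2l+1\in[n]$, then the sequence $b$ defined by $b_{2l+1}=a_{2l+1}-\lfloor \frac n2\rfloor$ and $b_{2l}=a_{2l}+\lfloor\frac{n+1}{2}\rfloor$ (for all indices in $[n]$) is a good sequence; (3) if $a_{2l+1}\le \lfloor \frac{n+1}{2}\rfloor$ for all $l$ with $2l+1\in[n]$, then the sequence $b$ defined by $b_{2l+1}=a_{2l+1}+\lfloor \frac n2\rfloor$ and $b_{2l}=a_{2l}-\lfloor\frac{n+1}{2}\rfloor$ (for all indices in $[n]$) is a good sequence.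
   Context: $[n]=\{1,2,\dots,n\}$. A permutation $a=(a_1,\dots,a_n)$ of $[n]$ is called a good sequence if the differences $|a_2-a_1|,\dots,|a_n-a_{n-1}|$ are pairwise distinct and one of the following holds: (i) $a_{2l+1}\ge\lceil\frac{n+1}{2}\rceil$ and $a_{2l}<\lceil\frac{n+1}{2}\rceil$ whenever $2l+1,2l\in[n]$; or (ii) $a_{2l+1}\le\lfloor\frac{n+1}{2}\rfloor$ and $a_{2l}>\lfloor\frac{n+1}{2}\rfloor$ whenever $2l+1,2l\in[n]$. -}

module Defs where

open import Data.Nat using (ℕ; zero; suc; _+_; _∸_; _*_; _≤_; _<_; ∣_-_∣; _/_)
open import Data.Fin using (Fin; toℕ; fromℕ<)
open import Data.Product using (_×_)
open import Data.Sum using (_⊎_)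
open import Relation.Binary.PropositionalEquality using (_≡_)
open import Function.Definitions using (Injective)

-- A sequence (a_1,…,a_n) is a function a : Fin n → ℕ; the entry a_i at
-- 1-based position i is  a k  where  i = toℕ k + 1.
-- Convenience: entry at 1-based position i (given i ≤ n, i ≥ 1 as i = suc m, m < n).
at : {n : ℕ} → (Fin n → ℕ) → (m : ℕ) → m < n → ℕ
at a m p = a (fromℕ< p)

-- a is a permutation of [n] = {1,…,n}: every entry lies in [n] and a is
-- injective (hence, by counting, a bijection onto [n]).
IsPerm : (n : ℕ) → (Fin n → ℕ) → Set
IsPerm n a = ((k : Fin n) → (1 ≤ a k) × (a k ≤ n)) × Injective _≡_ _≡_ a

-- The differences |a_{i+2} - a_{i+1}| (0-based i, i+1 < n) are pairwise distinct.
DistinctDiffs : (n : ℕ) → (Fin n → ℕ) → Set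
DistinctDiffs n a =
  (i j : ℕ) (pi : suc i < n) (pj : suc j < n) →
  ∣ at a (suc i) pi - at a i (<-weaken pi) ∣ ≡ ∣ at a (suc j) pj - at a j (<-weaken pj) ∣ →
  i ≡ j
  where
  <-weaken : {m : ℕ} → suc m < n → m < n
  <-weaken p = Data.Nat.Properties.<-trans (Data.Nat.Properties.n<1+n _) p
    where import Data.Nat.Properties

-- Position parity: 1-based position toℕ k + 1 is odd (= 2l+1) iff toℕ k = 2l.
OddPos : {n : ℕ} → Fin n → Set
OddPos {n} k = Data.Product.Σ ℕ (λ l → toℕ k ≡ 2 * l)
  where import Data.Product

EvenPos : {n : ℕ} → Fin n → Set
EvenPos {n} k = Data.Product.Σ ℕ (λ l → toℕ k ≡ 2 * l + 1)
  where import Data.Product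

-- ⌈(n+1)/2⌉ = ⌊(n+2)/2⌋ and ⌊(n+1)/2⌋
ceilHalf : ℕ → ℕ
ceilHalf n = (n + 2) / 2

floorHalf : ℕ → ℕ
floorHalf n = (n + 1) / 2

CondI : (n : ℕ) → (Fin n → ℕ) → Set
CondI n a = ((k : Fin n) → OddPos k → ceilHalf n ≤ a k)
          × ((k : Fin n) → EvenPos k → a k < ceilHalf n)

CondII : (n : ℕ) → (Fin n → ℕ) → Set
CondII n a = ((k : Fin n) → OddPos k → a k ≤ floorHalf n)
           × ((k : Fin n) → EvenPos k → floorHalf n < a k)

Good : (n : ℕ) → (Fin n → ℕ) → Set
Good n a = IsPerm n a × DistinctDiffs n a × (CondI n a ⊎ CondII n a)

complementSeq : (n : ℕ) → (Fin n → ℕ) → Fin n → ℕ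
complementSeq n a k = (n + 1) ∸ a k

shiftDown : (n : ℕ) → (Fin n → ℕ) → Fin n → ℕ
shiftDown n a k = go (toℕ k)
  where
  -- 0-based index even  ⇔  1-based position odd
  go : ℕ → ℕ
  go m with Data.Nat._%_ m 2
  ... | zero = a k ∸ (n / 2)
  ... | suc _ = a k + floorHalf n

shiftUp : (n : ℕ) → (Fin n → ℕ) → Fin n → ℕ
shiftUp n a k = go (toℕ k)
  where
  go : ℕ → ℕ
  go m with Data.Nat._%_ m 2
  ... | zero = a k + (n / 2)
  ... | suc _ = a k ∸ floorHalf n

-- (1) x ↦ n + 1 − x preserves |x − y| and exchanges the lower part [1, ⌊(n+1)/2⌋] of [n]
-- with the upper part [⌈(n+1)/2⌉, n], so it swaps conditions (i) and (ii).
-- (2), (3) Under the hypothesis, consecutive entries of a lie in opposite blocks [1, f] and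
-- (f, n], with f = ⌊n/2⌋ in (2) and f = ⌊(n+1)/2⌋ in (3), and b is a followed by the cyclic
-- rotation x ↦ x − f (mod n) of [n]. The rotation exchanges the blocks and turns each gap
-- |x − y| between opposite blocks into n − |x − y|, so the gaps of b are again distinct.
-- Condition (ii) in (2), resp. (i) in (3), is compatible with the hypothesis only for n = 1,
-- where there is nothing to prove.
module Submission where

open import Defs
open import Data.Nat using (ℕ; zero; suc; _+_; _*_; _∸_; _≤_; _<_; ∣_-_∣; _/_; _%_; z≤n; s≤s; s≤s⁻¹)
open import Data.Nat.Properties
open import Data.Nat.DivMod using (m/n≡1+[m∸n]/n; /-monoˡ-≤; m*n%n≡0; [m+kn]%n≡m%n)
open import Data.Fin using (Fin; zero; suc; toℕ; fromℕ<)
open import Data.Fin.Properties using (toℕ-fromℕ<)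
open import Data.Product using (Σ; _×_; _,_; proj₁; proj₂)
open import Data.Sum using (_⊎_; inj₁; inj₂; swap)
open import Function.Base using (id)
open import Function.Definitions using (Injective)
open import Relation.Nullary using (¬_; contradiction)
open import Relation.Binary.PropositionalEquality
open import Algebra.Properties.CommutativeSemigroup +-commutativeSemigroup using (x∙yz≈y∙xz; interchange)

[2+m]/2≡1+m/2 : ∀ m → suc (suc m) / 2 ≡ suc (m / 2)
[2+m]/2≡1+m/2 m = m/n≡1+[m∸n]/n {suc (suc m)} {2} (s≤s (s≤s z≤n))

ceilHalf≡1+n/2 : ∀ n → ceilHalf n ≡ suc (n / 2)
ceilHalf≡1+n/2 n = trans (cong (_/ 2) (+-comm n 2)) ([2+m]/2≡1+m/2 n)

n/2+floorHalf≡n : ∀ n → n / 2 + floorHalf n ≡ n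
n/2+floorHalf≡n zero = refl
n/2+floorHalf≡n (suc zero) = refl
n/2+floorHalf≡n (suc (suc n)) = begin
  suc (suc n) / 2 + floorHalf (suc (suc n)) ≡⟨ cong₂ _+_ ([2+m]/2≡1+m/2 n) ([2+m]/2≡1+m/2 (n + 1)) ⟩
  suc (n / 2) + suc (floorHalf n)           ≡⟨ cong suc (+-suc (n / 2) (floorHalf n)) ⟩
  suc (suc (n / 2 + floorHalf n))           ≡⟨ cong (λ m → suc (suc m)) (n/2+floorHalf≡n n) ⟩
  suc (suc n)                               ∎
  where open ≡-Reasoning

floorHalf+ceilHalf≡n+1 : ∀ n → floorHalf n + ceilHalf n ≡ n + 1
floorHalf+ceilHalf≡n+1 n = begin
  floorHalf n + ceilHalf n    ≡⟨ cong (floorHalf n +_) (ceilHalf≡1+n/2 n) ⟩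
  floorHalf n + suc (n / 2)   ≡⟨ +-suc (floorHalf n) (n / 2) ⟩
  suc (floorHalf n + n / 2)   ≡⟨ cong suc (+-comm (floorHalf n) (n / 2)) ⟩
  suc (n / 2 + floorHalf n)   ≡⟨ cong suc (n/2+floorHalf≡n n) ⟩
  suc n                       ≡⟨ +-comm 1 n ⟩
  n + 1                       ∎
  where open ≡-Reasoning

floorHalf≤ceilHalf : ∀ n → floorHalf n ≤ ceilHalf n
floorHalf≤ceilHalf n = /-monoˡ-≤ 2 (+-monoʳ-≤ n (n≤1+n 1))

even⇒suc-odd : ∀ {m} l → m ≡ 2 * l → suc m ≡ 2 * l + 1
even⇒suc-odd l refl = +-comm 1 (2 * l)

odd⇒suc-even : ∀ {m} l → m ≡ 2 * l + 1 → suc m ≡ 2 * suc l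
odd⇒suc-even l refl = begin
  suc (2 * l + 1)   ≡⟨ cong suc (+-comm (2 * l) 1) ⟩
  suc (suc (2 * l)) ≡⟨ sym (*-suc 2 l) ⟩
  2 * suc l         ∎
  where open ≡-Reasoning

parity : ∀ m → (Σ ℕ λ l → m ≡ 2 * l) ⊎ (Σ ℕ λ l → m ≡ 2 * l + 1)
parity zero = inj₁ (0 , refl)
parity (suc m) with parity m
... | inj₁ (l , e) = inj₂ (l , even⇒suc-odd l e)
... | inj₂ (l , e) = inj₁ (suc l , odd⇒suc-even l e)

oddPos⊎evenPos : ∀ {n} (k : Fin n) → OddPos k ⊎ EvenPos k
oddPos⊎evenPos k = parity (toℕ k)

-- Agrees definitionally with the weakening used in DistinctDiffs.
pred< : ∀ {m n} → suc m < n → m < n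
pred< p = <-trans (n<1+n _) p

Alternate : ∀ {n} → (Fin n → Set) → (Fin n → Set) → Set
Alternate {n} P Q = ∀ i (p : suc i < n) →
  (P (fromℕ< (pred< p)) × Q (fromℕ< p)) ⊎ (Q (fromℕ< (pred< p)) × P (fromℕ< p))

oddPos-evenPos-alternate : ∀ {n} → Alternate {n} OddPos EvenPos
oddPos-evenPos-alternate i p with parity i
... | inj₁ (l , e) = inj₁ ((l , trans (toℕ-fromℕ< (pred< p)) e) ,
                           (l , trans (toℕ-fromℕ< p) (even⇒suc-odd l e)))
... | inj₂ (l , e) = inj₂ ((l , trans (toℕ-fromℕ< (pred< p)) e) ,
                           (suc l , trans (toℕ-fromℕ< p) (odd⇒suc-even l e)))

oddPos⇒%2≡0 : ∀ {n} {k : Fin n} → OddPos k → toℕ k % 2 ≡ 0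
oddPos⇒%2≡0 (l , e) = trans (cong (_% 2) (trans e (*-comm 2 l))) (m*n%n≡0 l 2)

evenPos⇒%2≡1 : ∀ {n} {k : Fin n} → EvenPos k → toℕ k % 2 ≡ 1
evenPos⇒%2≡1 (l , e) =
  trans (cong (_% 2) (trans e (trans (+-comm (2 * l) 1) (cong suc (*-comm 2 l))))) ([m+kn]%n≡m%n 1 l 2)

shiftDown-oddPos : ∀ {n} (a : Fin n → ℕ) k → OddPos k → shiftDown n a k ≡ a k ∸ n / 2
shiftDown-oddPos a k o with toℕ k % 2 | oddPos⇒%2≡0 o
... | .0 | refl = refl

shiftDown-evenPos : ∀ {n} (a : Fin n → ℕ) k → EvenPos k → shiftDown n a k ≡ a k + floorHalf n
shiftDown-evenPos a k e with toℕ k % 2 | evenPos⇒%2≡1 e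
... | .1 | refl = refl

shiftUp-oddPos : ∀ {n} (a : Fin n → ℕ) k → OddPos k → shiftUp n a k ≡ a k + n / 2
shiftUp-oddPos a k o with toℕ k % 2 | oddPos⇒%2≡0 o
... | .0 | refl = refl

shiftUp-evenPos : ∀ {n} (a : Fin n → ℕ) k → EvenPos k → shiftUp n a k ≡ a k ∸ floorHalf n
shiftUp-evenPos a k e with toℕ k % 2 | evenPos⇒%2≡1 e
... | .1 | refl = refl

∣m-n∣≤o : ∀ {m n o} → m ≤ o → n ≤ o → ∣ m - n ∣ ≤ o
∣m-n∣≤o {m} {n} m≤o n≤o = ≤-trans (∣m-n∣≤m⊔n m n) (⊔-lub m≤o n≤o)

∣[o∸m]-[o∸n]∣≡∣m-n∣ : ∀ o m n → m ≤ o → n ≤ o → ∣ o ∸ m - o ∸ n ∣ ≡ ∣ m - n ∣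
∣[o∸m]-[o∸n]∣≡∣m-n∣ o zero zero _ _ = ∣n-n∣≡0 o
∣[o∸m]-[o∸n]∣≡∣m-n∣ o zero (suc n) _ n≤o =
  trans (m≤n⇒∣n-m∣≡n∸m (m∸n≤m o (suc n))) (m∸[m∸n]≡n n≤o)
∣[o∸m]-[o∸n]∣≡∣m-n∣ o (suc m) zero m≤o _ =
  trans (m≤n⇒∣m-n∣≡n∸m (m∸n≤m o (suc m))) (m∸[m∸n]≡n m≤o)
∣[o∸m]-[o∸n]∣≡∣m-n∣ (suc o) (suc m) (suc n) (s≤s m≤o) (s≤s n≤o) = ∣[o∸m]-[o∸n]∣≡∣m-n∣ o m n m≤o n≤o

-- With f = y + r, x = f + d and F = d + q both sides equal y + q.
rotate-gap : ∀ {f F n x y} → f + F ≡ n → f < x → x ≤ n → y ≤ f →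
  ∣ (y + F) - (x ∸ f) ∣ ≡ n ∸ ∣ y - x ∣
rotate-gap {f} {F} {y = y} refl f<x x≤n y≤f with m≤n⇒∃[o]m+o≡n (<⇒≤ f<x)
... | d , refl with m≤n⇒∃[o]m+o≡n (+-cancelˡ-≤ f d F x≤n)
... | q , refl with m≤n⇒∃[o]m+o≡n y≤f
... | r , refl = begin
  ∣ y + (d + q) - (y + r + d ∸ (y + r)) ∣  ≡⟨ cong (∣ y + (d + q) -_∣) (m+n∸m≡n (y + r) d) ⟩
  ∣ y + (d + q) - d ∣                      ≡⟨ cong ∣_- d ∣ (x∙yz≈y∙xz y d q) ⟩
  ∣ d + (y + q) - d ∣                      ≡⟨ ∣-∣-comm (d + (y + q)) d ⟩
  ∣ d - d + (y + q) ∣                      ≡⟨ ∣m-m+n∣≡n d (y + q) ⟩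
  y + q                                    ≡⟨ sym (m+n∸n≡m (y + q) (r + d)) ⟩
  y + q + (r + d) ∸ (r + d)                ≡⟨ cong (_∸ (r + d)) (interchange y q r d) ⟩
  y + r + (q + d) ∸ (r + d)                ≡⟨ cong (λ z → y + r + z ∸ (r + d)) (+-comm q d) ⟩
  y + r + (d + q) ∸ (r + d)                ≡⟨ cong (y + r + (d + q) ∸_) (sym (∣m-m+n∣≡n y (r + d))) ⟩
  y + r + (d + q) ∸ ∣ y - y + (r + d) ∣    ≡⟨ cong (λ z → y + r + (d + q) ∸ ∣ y - z ∣) (sym (+-assoc y r d)) ⟩
  y + r + (d + q) ∸ ∣ y - y + r + d ∣      ∎
  where open ≡-Reasoning

gap : ∀ {n} → (Fin n → ℕ) → (i : ℕ) → suc i < n → ℕ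
gap a i p = ∣ at a (suc i) p - at a i (pred< p) ∣

distinctDiffs-transport : ∀ {n} {a b : Fin n → ℕ} (g : ℕ → ℕ) →
  (∀ {x y} → x ≤ n → y ≤ n → g x ≡ g y → x ≡ y) → (∀ k → a k ≤ n) →
  (∀ i p → gap b i p ≡ g (gap a i p)) → DistinctDiffs n a → DistinctDiffs n b
distinctDiffs-transport {n} {a} g g-inj a≤n gap-b dd i j pi pj eq =
  dd i j pi pj (g-inj (gap≤n i pi) (gap≤n j pj) (trans (sym (gap-b i pi)) (trans eq (gap-b j pj))))
  where
  gap≤n : ∀ i p → gap a i p ≤ n
  gap≤n i p = ∣m-n∣≤o (a≤n _) (a≤n _)

module _ {p q N : ℕ} (p+q≡N : p + q ≡ N) where

  private
    N∸q≡p : N ∸ q ≡ p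
    N∸q≡p = subst (λ m → m ∸ q ≡ p) p+q≡N (m+n∸n≡m p q)

  q≤x⇒N∸x≤p : ∀ {x} → q ≤ x → N ∸ x ≤ p
  q≤x⇒N∸x≤p {x} q≤x = subst (N ∸ x ≤_) N∸q≡p (∸-monoʳ-≤ N q≤x)

  x≤q⇒p≤N∸x : ∀ {x} → x ≤ q → p ≤ N ∸ x
  x≤q⇒p≤N∸x {x} x≤q = subst (_≤ N ∸ x) N∸q≡p (∸-monoʳ-≤ N x≤q)

  x<q⇒p<N∸x : ∀ {x} → x < q → p < N ∸ x
  x<q⇒p<N∸x {x} x<q = subst (_< N ∸ x) N∸q≡p (∸-monoʳ-< x<q (subst (q ≤_) p+q≡N (m≤n+m q p)))

  q<x⇒N∸x<p : ∀ {x} → q < x → x ≤ N → N ∸ x < p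
  q<x⇒N∸x<p {x} q<x x≤N = subst (N ∸ x <_) N∸q≡p (∸-monoʳ-< q<x x≤N)

complementSeq-good : ∀ n (a : Fin n → ℕ) → Good n a → Good n (complementSeq n a)
complementSeq-good n a ((a-range , a-inj) , dd , cond) = (b-range , b-inj) , b-dd , map-cond cond
  where
  floor+ceil : floorHalf n + ceilHalf n ≡ n + 1
  floor+ceil = floorHalf+ceilHalf≡n+1 n
  ceil+floor : ceilHalf n + floorHalf n ≡ n + 1
  ceil+floor = trans (+-comm (ceilHalf n) (floorHalf n)) floor+ceil
  a≤n+1 : ∀ k → a k ≤ n + 1
  a≤n+1 k = m≤n⇒m≤n+o 1 (proj₂ (a-range k))
  b-range : ∀ k → 1 ≤ n + 1 ∸ a k × n + 1 ∸ a k ≤ n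
  b-range k = x≤q⇒p≤N∸x (+-comm 1 n) (proj₂ (a-range k)) , q≤x⇒N∸x≤p refl (proj₁ (a-range k))
  b-inj : Injective _≡_ _≡_ (complementSeq n a)
  b-inj eq = a-inj (∸-cancelˡ-≡ (a≤n+1 _) (a≤n+1 _) eq)
  b-dd : DistinctDiffs n (complementSeq n a)
  b-dd = distinctDiffs-transport {b = complementSeq n a} id (λ _ _ eq → eq) (λ k → proj₂ (a-range k))
    (λ i p → ∣[o∸m]-[o∸n]∣≡∣m-n∣ (n + 1) _ _ (a≤n+1 _) (a≤n+1 _)) dd
  map-cond : CondI n a ⊎ CondII n a → CondI n (complementSeq n a) ⊎ CondII n (complementSeq n a)
  map-cond (inj₁ (odd , even)) = inj₂ ((λ k o → q≤x⇒N∸x≤p floor+ceil (odd k o)) ,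
                                      (λ k e → x<q⇒p<N∸x floor+ceil (even k e)))
  map-cond (inj₂ (odd , even)) = inj₁ ((λ k o → x≤q⇒p≤N∸x ceil+floor (odd k o)) ,
                                      (λ k e → q<x⇒N∸x<p ceil+floor (even k e) (a≤n+1 k)))

module BlockRotation {n f F : ℕ} (f+F≡n : f + F ≡ n) {a b : Fin n → ℕ} (High Low : Fin n → Set)
  (high⊎low : ∀ k → High k ⊎ Low k) (alternate : Alternate High Low)
  (a-high : ∀ k → High k → f < a k) (a-low : ∀ k → Low k → a k ≤ f)
  (b-high : ∀ k → High k → b k ≡ a k ∸ f) (b-low : ∀ k → Low k → b k ≡ a k + F)
  (a-perm : IsPerm n a) where

  private
    a≤n : ∀ k → a k ≤ n
    a≤n k = proj₂ (proj₁ a-perm k)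

    F≤n : F ≤ n
    F≤n = subst (F ≤_) f+F≡n (m≤n+m F f)

  b-high-range : ∀ k → High k → 1 ≤ b k × b k ≤ F
  b-high-range k h rewrite b-high k h =
    subst (_≤ a k ∸ f) (m+n∸n≡m 1 f) (∸-monoˡ-≤ f (a-high k h)) ,
    subst (a k ∸ f ≤_) (trans (cong (_∸ f) (sym f+F≡n)) (m+n∸m≡n f F)) (∸-monoˡ-≤ f (a≤n k))

  b-low-range : ∀ k → Low k → F < b k × b k ≤ n
  b-low-range k l rewrite b-low k l =
    +-monoˡ-≤ F (proj₁ (proj₁ a-perm k)) ,
    subst (a k + F ≤_) f+F≡n (+-monoˡ-≤ F (a-low k l))

  b-injective : Injective _≡_ _≡_ b
  b-injective {k} {k′} eq with high⊎low k | high⊎low k′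
  ... | inj₁ h | inj₁ h′ = proj₂ a-perm (∸-cancelʳ-≡ (<⇒≤ (a-high k h)) (<⇒≤ (a-high k′ h′))
          (trans (sym (b-high k h)) (trans eq (b-high k′ h′))))
  ... | inj₂ l | inj₂ l′ = proj₂ a-perm (+-cancelʳ-≡ F (a k) (a k′)
          (trans (sym (b-low k l)) (trans eq (b-low k′ l′))))
  ... | inj₁ h | inj₂ l′ = contradiction (subst (_≤ F) eq (proj₂ (b-high-range k h)))
          (<⇒≱ (proj₁ (b-low-range k′ l′)))
  ... | inj₂ l | inj₁ h′ = contradiction (subst (_≤ F) (sym eq) (proj₂ (b-high-range k′ h′)))
          (<⇒≱ (proj₁ (b-low-range k l)))

  isPerm : IsPerm n b
  isPerm = (λ k → range k (high⊎low k)) , b-injective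
    where
    range : ∀ k → High k ⊎ Low k → 1 ≤ b k × b k ≤ n
    range k (inj₁ h) = proj₁ (b-high-range k h) , ≤-trans (proj₂ (b-high-range k h)) F≤n
    range k (inj₂ l) = ≤-trans (s≤s z≤n) (proj₁ (b-low-range k l)) , proj₂ (b-low-range k l)

  gap-rotate : ∀ i p → gap b i p ≡ n ∸ gap a i p
  gap-rotate i p with alternate i p
  ... | inj₁ (h , l) = trans (cong₂ ∣_-_∣ (b-low _ l) (b-high _ h))
          (rotate-gap f+F≡n (a-high _ h) (a≤n _) (a-low _ l))
  ... | inj₂ (l , h) = begin
    ∣ b v - b u ∣             ≡⟨ cong₂ ∣_-_∣ (b-high v h) (b-low u l) ⟩
    ∣ a v ∸ f - a u + F ∣     ≡⟨ ∣-∣-comm (a v ∸ f) (a u + F) ⟩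
    ∣ a u + F - a v ∸ f ∣     ≡⟨ rotate-gap f+F≡n (a-high v h) (a≤n v) (a-low u l) ⟩
    n ∸ ∣ a u - a v ∣         ≡⟨ cong (n ∸_) (∣-∣-comm (a u) (a v)) ⟩
    n ∸ ∣ a v - a u ∣         ∎
    where
    open ≡-Reasoning
    u v : Fin n
    u = fromℕ< (pred< p)
    v = fromℕ< p

  distinctDiffs : DistinctDiffs n a → DistinctDiffs n b
  distinctDiffs = distinctDiffs-transport {b = b} (n ∸_) ∸-cancelˡ-≡ a≤n gap-rotate

-- For n ≥ 3 both conditions force a_1 = a_3 = ⌈(n+1)/2⌉; for n = 2 they contradict each other.
condI∧condII⇒¬evenPos : ∀ {n} (a : Fin n → ℕ) → Injective _≡_ _≡_ a →
  (∀ k → OddPos k → ceilHalf n ≤ a k × a k ≤ floorHalf n) → (k : Fin n) → ¬ EvenPos k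
condI∧condII⇒¬evenPos {1} a _ _ zero (zero , ())
condI∧condII⇒¬evenPos {1} a _ _ zero (suc _ , ())
condI∧condII⇒¬evenPos {2} a _ squeezed _ _ with squeezed zero (0 , refl)
... | 2≤a , a≤1 = contradiction (≤-trans 2≤a a≤1) λ { (s≤s ()) }
condI∧condII⇒¬evenPos {n@(suc (suc (suc _)))} a a-inj squeezed _ _ =
  contradiction (a-inj (trans (a≡ceilHalf zero (0 , refl)) (sym (a≡ceilHalf k₂ (1 , refl))))) λ ()
  where
  k₂ : Fin n
  k₂ = suc (suc zero)
  a≡ceilHalf : ∀ k → OddPos k → a k ≡ ceilHalf n
  a≡ceilHalf k o with squeezed k o
  ... | ceil≤a , a≤floor = ≤-antisym (≤-trans a≤floor (floorHalf≤ceilHalf n)) ceil≤a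

shiftDown-good : ∀ n (a : Fin n → ℕ) → Good n a →
  (∀ k → OddPos k → ceilHalf n ≤ a k) → Good n (shiftDown n a)
shiftDown-good n a (a-perm , dd , cond) odd-high =
  R.isPerm , R.distinctDiffs dd ,
  inj₂ ((λ k o → proj₂ (R.b-high-range k o)) , (λ k e → proj₁ (R.b-low-range k e)))
  where
  a-high : ∀ k → OddPos k → n / 2 < a k
  a-high k o = subst (_≤ a k) (ceilHalf≡1+n/2 n) (odd-high k o)
  a-low : ∀ k → EvenPos k → a k ≤ n / 2
  a-low k e = from cond
    where
    from : CondI n a ⊎ CondII n a → a k ≤ n / 2
    from (inj₁ (_ , even)) = s≤s⁻¹ (subst (a k <_) (ceilHalf≡1+n/2 n) (even k e))
    from (inj₂ (odd , _)) =
      contradiction e (condI∧condII⇒¬evenPos a (proj₂ a-perm) (λ k o → odd-high k o , odd k o) k)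
  module R = BlockRotation (n/2+floorHalf≡n n) OddPos EvenPos oddPos⊎evenPos oddPos-evenPos-alternate
    a-high a-low (shiftDown-oddPos a) (shiftDown-evenPos a) a-perm

shiftUp-good : ∀ n (a : Fin n → ℕ) → Good n a →
  (∀ k → OddPos k → a k ≤ floorHalf n) → Good n (shiftUp n a)
shiftUp-good n a (a-perm , dd , cond) odd-low =
  R.isPerm , R.distinctDiffs dd ,
  inj₁ ((λ k o → subst (_≤ shiftUp n a k) (sym (ceilHalf≡1+n/2 n)) (proj₁ (R.b-low-range k o))) ,
        (λ k e → subst (shiftUp n a k <_) (sym (ceilHalf≡1+n/2 n)) (s≤s (proj₂ (R.b-high-range k e)))))
  where
  a-high : ∀ k → EvenPos k → floorHalf n < a k
  a-high k e = from cond
    where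
    from : CondI n a ⊎ CondII n a → floorHalf n < a k
    from (inj₁ (odd , _)) =
      contradiction e (condI∧condII⇒¬evenPos a (proj₂ a-perm) (λ k o → odd k o , odd-low k o) k)
    from (inj₂ (_ , even)) = even k e
  module R = BlockRotation (trans (+-comm (floorHalf n) (n / 2)) (n/2+floorHalf≡n n)) EvenPos OddPos
    (λ k → swap (oddPos⊎evenPos k)) (λ i p → swap (oddPos-evenPos-alternate i p))
    a-high odd-low (shiftUp-evenPos a) (shiftUp-oddPos a) a-perm

lemma1 : (n : ℕ) → 1 ≤ n → (a : Fin n → ℕ) → Good n a →
    Good n (complementSeq n a)
    × (((k : Fin n) → OddPos k → ceilHalf n ≤ a k) → Good n (shiftDown n a))
    × (((k : Fin n) → OddPos k → a k ≤ floorHalf n) → Good n (shiftUp n a))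
lemma1 n _ a good = complementSeq-good n a good , shiftDown-good n a good , shiftUp-good n a good
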